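{- Let $n\ge1$, $m\ge0$, and let $f_d\cdots f_1$ be the word corresponding to a geodesic (shortest path) between two vertices of the dYoke graph $Z_{n,m}$. Then for every $0\le i\le m$, the letters $\overleftarrow{s}_i$ and $\overrightarrow{s}_i$ do not both occur in $f_d\cdots f_1$ (i.e., all instances of $s_i$ shift in the same direction).
   Context: Elements of $\mathbb{Z}_n$ are identified with their smallest nonnegative representatives in $\{0,\dots,n-1\}$. The dYoke graph $Z_{n,m}$ has as vertices all tuples $u=(u_0,\dots,u_{m+1})$ with $u_0,u_{m+1}\in\mathbb{Z}_n$, $u_1,\dots,u_m\in\{ -1,0,1\}$ and $\sum_{i=0}^{m+1}u_i\equiv0\pmod n$. Vertices $u,v$ are adjacent if there is $0\le i\le m$ with $u_j=v_j$ for $j\notin\{i,i+1\}$ and either ($u_i=v_i+1$, $u_{i+1}=v_{i+1}-1$) or ($u_i=v_i-1$, $u_{i+1}=v_{i+1}+1$), arithmetic in coordinates $0,m+1$ being in $\mathbb{Z}_n$. For $0\le i\le m$ and a vertex $v$, $\overleftarrow{s}_i(v)$ is the tuple obtained from $v$ by adding $1$ to entry $i$ and subtracting $1$ from entry $i+1$ (shifting a unit left), if that tuple is a vertex, and $v$ otherwise; $\overrightarrow{s}_i(v)$ is defined likewise by subtracting $1$ from entry $i$ and adding $1$ to entry $i+1$. The word corresponding to a path $v=v^0\sim v^1\sim\dots\sim v^d$ is $f_d\cdots f_1$ where each $f_t\in\{\overleftarrow{s}_i,\overrightarrow{s}_i:0\le i\le m\}$ and $f_t(v^{t-1})=v^t$.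 -}

module Defs where

open import Data.Nat as ℕ using (ℕ; zero; suc; NonZero)
open import Data.Integer as ℤ using (ℤ; +_; -[1+_]; _%ℕ_)
open import Data.Integer.Divisibility using (_∣_)
open import Data.Fin using (Fin; zero; suc; toℕ; inject₁)
open import Data.Vec using (Vec; []; _∷_; updateAt; foldr)
open import Data.Bool using (Bool; true; false; if_then_else_)
open import Data.List using (List; []; _∷_)
open import Data.Product using (Σ; _×_; _,_; ∃)
open import Data.Sum using (_⊎_)
open import Relation.Nullary using (¬_)
open import Relation.Binary.PropositionalEquality using (_≡_)

-- A tuple (u_0, u_1, ..., u_m, u_{m+1}) of integers; u_0 and u_{m+1}
-- represent elements of Z_n by their representatives in {0,...,n-1}.
Tuple : ℕ → Set
Tuple m = Vec ℤ (suc (suc m))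

-- Position 0 and position m+1 are the Z_n-coordinates.
isBoundary : {m : ℕ} → Fin (suc (suc m)) → Bool
isBoundary zero = true
isBoundary {m} (suc j) = toℕ j ℕ.≡ᵇ m

tupleSum : {k : ℕ} → Vec ℤ k → ℤ
tupleSum = foldr _ ℤ._+_ (+ 0)

InZn : ℕ → ℤ → Set
InZn n x = Σ ℕ λ k → (k ℕ.< n) × (x ≡ + k)

InTri : ℤ → Set
InTri x = (x ≡ -[1+ 0 ]) ⊎ (x ≡ + 0) ⊎ (x ≡ + 1)

data Middle : {k : ℕ} → Vec ℤ k → Set where
  []  : Middle []
  _∷_ : {k : ℕ} {x : ℤ} {xs : Vec ℤ k} → InTri x → Middle xs → Middle (x ∷ xs)

data VertexShape (n : ℕ) : {m : ℕ} → Tuple m → Set where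
  shape0 : {a b : ℤ} → InZn n a → InZn n b → VertexShape n {0} (a ∷ b ∷ [])
  shapeS : {m : ℕ} {a x : ℤ} {xs : Vec ℤ (suc m)} →
           InTri x → VertexShape n {m} (a ∷ xs) → VertexShape n {suc m} (a ∷ x ∷ xs)

IsVertex : (n m : ℕ) → Tuple m → Set
IsVertex n m u = VertexShape n u × (+ n ∣ tupleSum u)

bump : (n m : ℕ) .{{_ : NonZero n}} → Fin (suc (suc m)) → ℤ → Tuple m → Tuple m
bump n m p δ u = updateAt u p (λ x → if isBoundary {m} p then + ((x ℤ.+ δ) %ℕ n) else x ℤ.+ δ)

data Dir : Set where
  left right : Dir

-- Letters: (left , i) is s⃖_i, (right , i) is s⃗_i, for 0 ≤ i ≤ m.
Letter : ℕ → Set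
Letter m = Dir × Fin (suc m)

-- The tuple obtained by shifting a unit at positions i, i+1 (not yet checked to be a vertex).
candidate : (n m : ℕ) .{{_ : NonZero n}} → Letter m → Tuple m → Tuple m
candidate n m (left , i)  u = bump n m (suc i) (-[1+ 0 ]) (bump n m (inject₁ i) (+ 1) u)
candidate n m (right , i) u = bump n m (suc i) (+ 1) (bump n m (inject₁ i) (-[1+ 0 ]) u)

Apply : (n m : ℕ) .{{_ : NonZero n}} → Letter m → Tuple m → Tuple m → Set
Apply n m f u w =
  (IsVertex n m (candidate n m f u) × w ≡ candidate n m f u)
  ⊎ (¬ IsVertex n m (candidate n m f u) × w ≡ u)

Adj : (n m : ℕ) .{{_ : NonZero n}} → Tuple m → Tuple m → Set
Adj n m u v = IsVertex n m u × IsVertex n m v ×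
  (Σ (Fin (suc m)) λ i → (u ≡ candidate n m (left , i) v) ⊎ (u ≡ candidate n m (right , i) v))

data Path (n m : ℕ) .{{_ : NonZero n}} : Tuple m → Tuple m → Set where
  stop : {u : Tuple m} → IsVertex n m u → Path n m u u
  step : {u v w : Tuple m} → Adj n m u v → Path n m v w → Path n m u w

len : {n m : ℕ} .{{_ : NonZero n}} {u v : Tuple m} → Path n m u v → ℕ
len (stop _) = 0
len (step _ p) = suc (len p)

IsGeodesic : (n m : ℕ) .{{_ : NonZero n}} {u v : Tuple m} → Path n m u v → Set
IsGeodesic n m {u} {v} p = (q : Path n m u v) → len p ℕ.≤ len q

-- WordOf p w : w = [f_1, ..., f_d] is a word corresponding to p, i.e. f_t(v^{t-1}) = v^t.
-- (The list is in path order; the paper writes the word as f_d ⋯ f_1.)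
data WordOf (n m : ℕ) .{{_ : NonZero n}} : {u v : Tuple m} → Path n m u v → List (Letter m) → Set where
  stop : {u : Tuple m} {x : IsVertex n m u} → WordOf n m (stop x) []
  step : {u v w : Tuple m} {a : Adj n m u v} {p : Path n m v w} {f : Letter m} {ws : List (Letter m)} →
         Apply n m f u v → WordOf n m p ws → WordOf n m (step a p) (f ∷ ws)

module Submission where

-- Idea: encode a vertex u by its height function h, h j = u_0 + … + u_j read in ℤ.
-- It is Lipschitz (neighbouring heights differ by at most one) on [0, m], and
-- conversely every Lipschitz h projects to a vertex π h (the two Z_n-coordinates
-- being the residues of h 0 and of -h m).  The letter s⃖_i (resp. s⃗_i) acts on
-- heights by raising (resp. lowering) h i by one and nothing else.
--
-- If both s⃖_i and s⃗_i occur in w then |g i - h i| is strictly less than the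
-- number of letters at i, so dist h g < length w, and the monotone path beats
-- the geodesic.

open import Defs
open import Data.Nat using (ℕ; suc; NonZero)
open import Data.Fin using (Fin)
open import Data.List using (List)
open import Data.List.Membership.Propositional using (_∈_)
open import Data.Product using (_×_; _,_)
open import Relation.Nullary using (¬_)

open import Function using (_∘_)
open import Data.Nat as ℕ using (zero; _≡ᵇ_; z≤n; s≤s; _⊔_)
import Data.Nat.Properties as ℕP
import Data.Nat.Divisibility as ℕD
open import Data.Nat.DivMod using (m<n⇒m%n≡m)
open import Data.Nat.Induction using (<-wellFounded)
open import Induction.WellFounded using (Acc; acc)
open import Data.Integer as ℤ using (ℤ; +_; -[1+_]; _%ℕ_; _/ℕ_; ∣_∣; _+_; _-_; -_; _*_; _≤_; _<_)
import Data.Integer.Properties as ℤP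
open import Data.Integer.DivMod using (a≡a%ℕn+[a/ℕn]*n; n%ℕd<d)
import Data.Integer.Divisibility.Signed as ℤD
open import Data.Integer.Tactic.RingSolver using (solve-∀)
open import Data.Fin using (zero; suc; toℕ; inject₁; fromℕ<)
import Data.Fin.Properties as FinP
open import Data.Vec using (Vec; []; _∷_; updateAt; tabulate)
open import Data.Bool using (true; false; if_then_else_; _∨_)
open import Data.List using ([]; _∷_; length)
open import Data.List.Relation.Unary.Any using (here; there)
open import Data.Product using (Σ; proj₁; proj₂)
open import Data.Sum using (_⊎_; inj₁; inj₂; [_,_]′)
open import Data.Empty using (⊥-elim)
open import Relation.Nullary using (yes; no)
open import Relation.Nullary.Decidable using (dec-true; dec-false)
open import Relation.Unary using (Decidable)
open import Relation.Binary.PropositionalEquality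

add-sub-cancel : ∀ a b → (a + b) - a ≡ b
add-sub-cancel = solve-∀

module Residues (n : ℕ) .{{_ : NonZero n}} where

  divisor-below : ∀ {d} → d ℕ.< n → n ℕD.∣ d → d ≡ 0
  divisor-below {zero}  _   _   = refl
  divisor-below {suc _} d<n n∣d = ⊥-elim (ℕD.>⇒∤ d<n n∣d)

  residue-unique : ∀ {a b} → a ℕ.< n → b ℕ.< n → + n ℤD.∣ (+ a - + b) → a ≡ b
  residue-unique {a} {b} a<n b<n n∣a-b =
    ℤP.+-injective (ℤP.i-j≡0⇒i≡j (+ a) (+ b)
      (ℤP.∣i∣≡0⇒i≡0 (divisor-below ∣a-b∣<n (ℤD.∣⇒∣ᵤ n∣a-b))))
    where
    ∣a-b∣<n : ∣ + a - + b ∣ ℕ.< n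
    ∣a-b∣<n = subst (ℕ._< n) (cong ∣_∣ (sym (ℤP.m-n≡m⊖n a b)))
                (ℕP.≤-<-trans (ℤP.∣m⊝n∣≤m⊔n a b) (ℕP.⊔-lub a<n b<n))

  residue-congruent : ∀ x → + n ℤD.∣ (x - + (x %ℕ n))
  residue-congruent x = ℤD.divides (x /ℕ n) (begin
      x - + r                      ≡⟨ cong (_- + r) (a≡a%ℕn+[a/ℕn]*n x n) ⟩
      (+ r + (x /ℕ n) * + n) - + r ≡⟨ add-sub-cancel (+ r) ((x /ℕ n) * + n) ⟩
      (x /ℕ n) * + n               ∎)
    where
    open ≡-Reasoning
    r : ℕ
    r = x %ℕ n

  residue-cong : ∀ x y → + n ℤD.∣ (x - y) → x %ℕ n ≡ y %ℕ n
  residue-cong x y n∣x-y = residue-unique (n%ℕd<d x n) (n%ℕd<d y n)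
    (subst (+ n ℤD.∣_) (regroup x y (+ (x %ℕ n)) (+ (y %ℕ n)))
      (ℤD.∣m∣n⇒∣m+n (ℤD.∣m∣n⇒∣m-n n∣x-y (residue-congruent x)) (residue-congruent y)))
    where
    regroup : ∀ x y a b → (x - y) - (x - a) + (y - b) ≡ a - b
    regroup = solve-∀

  -- Taking residues commutes with adding δ; this is how bump treats Z_n-coordinates.
  residue-+ : ∀ x δ → (+ (x %ℕ n) + δ) %ℕ n ≡ (x + δ) %ℕ n
  residue-+ x δ = residue-cong (+ (x %ℕ n) + δ) (x + δ)
    (subst (+ n ℤD.∣_) (regroup x δ (+ (x %ℕ n))) (ℤD.∣m⇒∣-m (residue-congruent x)))
    where
    regroup : ∀ x δ r → - (x - r) ≡ (r + δ) - (x + δ)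
    regroup = solve-∀

open Residues

≡ᵇ-refl : ∀ a → (a ≡ᵇ a) ≡ true
≡ᵇ-refl a = dec-true (a ℕ.≟ a) refl

≢⇒≡ᵇ-false : ∀ {a b} → a ≢ b → (a ≡ᵇ b) ≡ false
≢⇒≡ᵇ-false {a} {b} a≢b = dec-false (a ℕ.≟ b) a≢b

below-or-last : ∀ {A : Set} {j k} → j ℕ.< suc k → (j ℕ.< k → A) → (j ≡ k → A) → A
below-or-last j<1+k below last = [ below , last ]′ (ℕP.m<1+n⇒m<n∨m≡n j<1+k)

pred-< : ∀ x → x - + 1 < x
pred-< x = ℤP.i≤pred[j]⇒i<j (ℤP.≤-reflexive (ℤP.+-comm x -[1+ 0 ]))

<⇒0<- : ∀ {a b} → a < b → + 0 < b - a
<⇒0<- {a} {b} a<b = subst (_< b - a) (ℤP.+-inverseʳ a) (ℤP.+-monoˡ-< (- a) a<b)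

∣pred∣< : ∀ x → + 0 < x → ∣ x - + 1 ∣ ℕ.< ∣ x ∣
∣pred∣< (+ suc k) _ = ℕP.n<1+n k
∣pred∣< (+ zero) (ℤ.+<+ ())

∣∣≤⊔ : ∀ x a b → x ≤ + a → - x ≤ + b → ∣ x ∣ ℕ.≤ a ⊔ b
∣∣≤⊔ (+ k)    a b (ℤ.+≤+ k≤a) _           = ℕP.≤-trans k≤a (ℕP.m≤m⊔n a b)
∣∣≤⊔ -[1+ k ] a b _           (ℤ.+≤+ k≤b) = ℕP.≤-trans k≤b (ℕP.m≤n⊔m a b)

-- max a b < a + b once both are positive: the strict step of the final count.
⊔<+ : ∀ {a b} → 1 ℕ.≤ a → 1 ℕ.≤ b → a ⊔ b ℕ.< a ℕ.+ b
⊔<+ {a} {b} 1≤a 1≤b = [ (λ e → subst (ℕ._< a ℕ.+ b) (sym e) (ℕP.m<m+n a 1≤b))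
                      , (λ e → subst (ℕ._< a ℕ.+ b) (sym e) (ℕP.m<n+m b 1≤a)) ]′ (ℕP.⊔-sel a b)

-- Σℤ F k = F 0 + … + F (k - 1), unfolded from the left like tupleSum; Σℕ likewise.
Σℤ : (ℕ → ℤ) → ℕ → ℤ
Σℤ F zero    = + 0
Σℤ F (suc k) = F 0 + Σℤ (λ j → F (suc j)) k

Σℤ-cong : ∀ F G k → (∀ j → j ℕ.< k → F j ≡ G j) → Σℤ F k ≡ Σℤ G k
Σℤ-cong F G zero    _   = refl
Σℤ-cong F G (suc k) F≗G =
  cong₂ _+_ (F≗G 0 (s≤s z≤n)) (Σℤ-cong _ _ k (λ j j<k → F≗G (suc j) (s≤s j<k)))

Σℤ-snoc : ∀ F k → Σℤ F (suc k) ≡ Σℤ F k + F k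
Σℤ-snoc F zero    = ℤP.+-comm (F 0) (+ 0)
Σℤ-snoc F (suc k) =
  trans (cong (_+_ (F 0)) (Σℤ-snoc (λ j → F (suc j)) k)) (sym (ℤP.+-assoc (F 0) _ _))

telescope : ∀ (h : ℕ → ℤ) k → Σℤ (λ j → h (suc j) - h j) k ≡ h k - h 0
telescope h zero    = sym (ℤP.+-inverseʳ (h 0))
telescope h (suc k) = begin
  Σℤ D (suc k)                    ≡⟨ Σℤ-snoc D k ⟩
  Σℤ D k + D k                    ≡⟨ cong (_+ D k) (telescope h k) ⟩
  (h k - h 0) + (h (suc k) - h k) ≡⟨ collapse (h 0) (h k) (h (suc k)) ⟩
  h (suc k) - h 0                 ∎
  where
  open ≡-Reasoning
  D : ℕ → ℤ
  D j = h (suc j) - h j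
  collapse : ∀ a b c → (b - a) + (c - b) ≡ c - a
  collapse = solve-∀

Σℕ : (ℕ → ℕ) → ℕ → ℕ
Σℕ F zero    = 0
Σℕ F (suc k) = F 0 ℕ.+ Σℕ (λ j → F (suc j)) k

Σℕ-zero : ∀ k → Σℕ (λ _ → 0) k ≡ 0
Σℕ-zero zero    = refl
Σℕ-zero (suc k) = Σℕ-zero k

Σℕ-cong : ∀ F G k → (∀ j → F j ≡ G j) → Σℕ F k ≡ Σℕ G k
Σℕ-cong F G zero    _   = refl
Σℕ-cong F G (suc k) F≗G = cong₂ ℕ._+_ (F≗G 0) (Σℕ-cong _ _ k (F≗G ∘ suc))

Σℕ-mono-≤ : ∀ F G k → (∀ j → j ℕ.< k → F j ℕ.≤ G j) → Σℕ F k ℕ.≤ Σℕ G k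
Σℕ-mono-≤ F G zero    _   = z≤n
Σℕ-mono-≤ F G (suc k) F≤G =
  ℕP.+-mono-≤ (F≤G 0 (s≤s z≤n)) (Σℕ-mono-≤ _ _ k (λ j j<k → F≤G (suc j) (s≤s j<k)))

Σℕ-mono-< : ∀ F G k p → p ℕ.< k → (∀ j → j ℕ.< k → F j ℕ.≤ G j) → F p ℕ.< G p →
            Σℕ F k ℕ.< Σℕ G k
Σℕ-mono-< F G (suc k) zero    _         F≤G Fp<Gp =
  ℕP.+-mono-<-≤ Fp<Gp (Σℕ-mono-≤ _ _ k (λ j j<k → F≤G (suc j) (s≤s j<k)))
Σℕ-mono-< F G (suc k) (suc p) (s≤s p<k) F≤G Fp<Gp =
  ℕP.+-mono-≤-< (F≤G 0 (s≤s z≤n))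
    (Σℕ-mono-< _ _ k p p<k (λ j j<k → F≤G (suc j) (s≤s j<k)) Fp<Gp)

Σℕ-point : ∀ F G k p → p ℕ.< k → (∀ j → j ≢ p → G j ≡ F j) → G p ≡ suc (F p) →
           Σℕ G k ≡ suc (Σℕ F k)
Σℕ-point F G (suc k) zero    _         off at =
  cong₂ ℕ._+_ at (Σℕ-cong _ _ k (λ j → off (suc j) λ ()))
Σℕ-point F G (suc k) (suc p) (s≤s p<k) off at =
  trans (cong₂ ℕ._+_ (off 0 λ ())
          (Σℕ-point _ _ k p p<k (λ j j≢p → off (suc j) (j≢p ∘ ℕP.suc-injective)) at))
        (ℕP.+-suc (F 0) _)

-- Entry t of a vector (0 past its end), indexed by ℕ so that positions can be
-- compared arithmetically.
entry : ∀ {k} → Vec ℤ k → ℕ → ℤ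
entry []       _       = + 0
entry (x ∷ _)  zero    = x
entry (_ ∷ xs) (suc t) = entry xs t

entry-ext : ∀ {k} (u v : Vec ℤ k) → (∀ t → t ℕ.< k → entry u t ≡ entry v t) → u ≡ v
entry-ext []      []      _   = refl
entry-ext (x ∷ u) (y ∷ v) u≗v =
  cong₂ _∷_ (u≗v 0 (s≤s z≤n)) (entry-ext u v (λ t t<k → u≗v (suc t) (s≤s t<k)))

entry-tabulate : ∀ {k} (G : ℕ → ℤ) t → t ℕ.< k →
                 entry (tabulate {n = k} (λ i → G (toℕ i))) t ≡ G t
entry-tabulate {suc k} G zero    _         = refl
entry-tabulate {suc k} G (suc t) (s≤s t<k) = entry-tabulate {k} (λ j → G (suc j)) t t<k

entry-updateAt-here : ∀ {k} (u : Vec ℤ k) p g → entry (updateAt u p g) (toℕ p) ≡ g (entry u (toℕ p))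
entry-updateAt-here (x ∷ u) zero    g = refl
entry-updateAt-here (x ∷ u) (suc p) g = entry-updateAt-here u p g

entry-updateAt-there : ∀ {k} (u : Vec ℤ k) p g t → t ≢ toℕ p → entry (updateAt u p g) t ≡ entry u t
entry-updateAt-there (x ∷ u) zero    g zero    t≢p = ⊥-elim (t≢p refl)
entry-updateAt-there (x ∷ u) zero    g (suc t) _   = refl
entry-updateAt-there (x ∷ u) (suc p) g zero    _   = refl
entry-updateAt-there (x ∷ u) (suc p) g (suc t) t≢p = entry-updateAt-there u p g t (t≢p ∘ cong suc)

tupleSum-entries : ∀ {k} (u : Vec ℤ k) → tupleSum u ≡ Σℤ (entry u) k
tupleSum-entries []      = refl
tupleSum-entries (x ∷ u) = cong (_+_ x) (tupleSum-entries u)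

ShapeEntries : (n m : ℕ) → Tuple m → Set
ShapeEntries n m u =
  InZn n (entry u 0) × InZn n (entry u (suc m)) × (∀ j → j ℕ.< m → InTri (entry u (suc j)))

shape⇒entries : ∀ {n m} {u : Tuple m} → VertexShape n u → ShapeEntries n m u
shape⇒entries (shape0 first last) = first , last , λ _ ()
shape⇒entries (shapeS x shape) with shape⇒entries shape
... | first , last , middle = first , last , λ { zero _ → x ; (suc j) (s≤s j<m) → middle j j<m }

entries⇒shape : ∀ {n m} (u : Tuple m) → ShapeEntries n m u → VertexShape n u
entries⇒shape {m = zero}  (a ∷ b ∷ [])     (first , last , _)      = shape0 first last
entries⇒shape {m = suc m} (a ∷ x ∷ xs) (first , last , middle) =
  shapeS (middle 0 (s≤s z≤n))
         (entries⇒shape (a ∷ xs) (first , last , λ j j<m → middle (suc j) (s≤s j<m)))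

-- Height functions; a vertex u is encoded by h j = u_0 + … + u_j.
Height : Set
Height = ℕ → ℤ

shiftAt : Height → ℕ → ℤ → Height
shiftAt h s δ j = if j ≡ᵇ s then h j + δ else h j

shiftAt-here : ∀ h s δ → shiftAt h s δ s ≡ h s + δ
shiftAt-here h s δ rewrite ≡ᵇ-refl s = refl

shiftAt-there : ∀ h s δ j → j ≢ s → shiftAt h s δ j ≡ h j
shiftAt-there h s δ j j≢s rewrite ≢⇒≡ᵇ-false j≢s = refl

shiftAt-cancel : ∀ h s δ j → shiftAt (shiftAt h s δ) s (- δ) j ≡ h j
shiftAt-cancel h s δ j with j ℕ.≟ s
... | yes refl = trans (shiftAt-here (shiftAt h j δ) j (- δ))
                   (trans (cong (_+ - δ) (shiftAt-here h j δ)) (cancel (h j) δ))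
  where
  cancel : ∀ x d → (x + d) + - d ≡ x
  cancel = solve-∀
... | no j≢s = trans (shiftAt-there (shiftAt h s δ) s (- δ) j j≢s) (shiftAt-there h s δ j j≢s)

Near : ℤ → ℤ → Set
Near x y = InTri (x - y)

Lip : ℕ → Height → Set
Lip m h = ∀ j → j ℕ.< m → Near (h (suc j)) (h j)

tri-neg : ∀ {t} → InTri t → InTri (- t)
tri-neg (inj₁ refl)        = inj₂ (inj₂ refl)
tri-neg (inj₂ (inj₁ refl)) = inj₂ (inj₁ refl)
tri-neg (inj₂ (inj₂ refl)) = inj₁ refl

near-sym : ∀ {x y} → Near x y → Near y x
near-sym {x} {y} near = subst InTri (flip x y) (tri-neg near)
  where
  flip : ∀ x y → - (x - y) ≡ y - x
  flip = solve-∀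

near-pred≤ : ∀ {x y} → Near x y → y - + 1 ≤ x
near-pred≤ {x} {y} near =
  subst (y - + 1 ≤_) (sym (recompose x y)) (ℤP.+-monoʳ-≤ y (lower near))
  where
  recompose : ∀ x y → x ≡ y + (x - y)
  recompose = solve-∀
  lower : ∀ {t} → InTri t → -[1+ 0 ] ≤ t
  lower (inj₁ refl)        = ℤP.≤-refl
  lower (inj₂ (inj₁ refl)) = ℤ.-≤+
  lower (inj₂ (inj₂ refl)) = ℤ.-≤+

-- s⃖_i raises h i, s⃗_i lowers it.
unitStep : Dir → ℤ
unitStep left  = + 1
unitStep right = -[1+ 0 ]

opposite : Dir → Dir
opposite left  = right
opposite right = left

unitStep-opposite : ∀ d → unitStep (opposite d) ≡ - unitStep d
unitStep-opposite left  = refl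
unitStep-opposite right = refl

signed : Dir → ℤ → ℤ
signed left  x = x
signed right x = - x

move : ∀ {m} → Letter m → Height → Height
move (d , i) h = shiftAt h (toℕ i) (unitStep d)

signed-zero≤ : ∀ d k → signed d (+ 0) ≤ + k
signed-zero≤ left  k = ℤ.+≤+ z≤n
signed-zero≤ right k = ℤ.+≤+ z≤n

signed-∣∣ : ∀ d x → ∣ signed d x ∣ ≡ ∣ x ∣
signed-∣∣ left  x = refl
signed-∣∣ right x = ℤP.∣-i∣≡∣i∣ x

signed-diff : ∀ d x y → signed d (x - y) ≡ signed d x - signed d y
signed-diff left  x y = refl
signed-diff right x y = ℤP.neg-distrib-+ x (- y)

signed-back : ∀ d x → signed d (x - unitStep d) ≡ signed d x - + 1
signed-back left  x = refl
signed-back right x = ℤP.neg-distrib-+ x (+ 1)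

signed-split : ∀ d a b c → signed d (c - a) ≡ signed d (b - a) + signed d (c - b)
signed-split left  a b c = split a b c
  where
  split : ∀ a b c → c - a ≡ (b - a) + (c - b)
  split = solve-∀
signed-split right a b c = split a b c
  where
  split : ∀ a b c → - (c - a) ≡ - (b - a) + - (c - b)
  split = solve-∀

Lip-signed : ∀ {m h} d → Lip m h → Lip m (λ j → signed d (h j))
Lip-signed left  lip = lip
Lip-signed {h = h} right lip j j<m =
  subst InTri (signed-diff right (h (suc j)) (h j)) (tri-neg (lip j j<m))

near-move : ∀ d {x y} → Near x y → y ≢ x - unitStep d → Near (x + unitStep d) y
near-move d {x} {y} near y≢ =
  subst InTri (regroup x y (unitStep d)) (tri-move d near (λ e → y≢ (back x y (unitStep d) e)))
  where
  regroup : ∀ x y δ → (x - y) + δ ≡ (x + δ) - y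
  regroup = solve-∀
  back : ∀ x y δ → x - y ≡ δ → y ≡ x - δ
  back x y δ e = trans (recompose x y) (cong (_-_ x) e)
    where
    recompose : ∀ x y → y ≡ x - (x - y)
    recompose = solve-∀
  tri-move : ∀ d {t} → InTri t → t ≢ unitStep d → InTri (t + unitStep d)
  tri-move left  (inj₁ refl)        _   = inj₂ (inj₁ refl)
  tri-move left  (inj₂ (inj₁ refl)) _   = inj₂ (inj₂ refl)
  tri-move left  (inj₂ (inj₂ refl)) t≢1 = ⊥-elim (t≢1 refl)
  tri-move right (inj₁ refl)        t≢δ = ⊥-elim (t≢δ refl)
  tri-move right (inj₂ (inj₁ refl)) _   = inj₁ refl
  tri-move right (inj₂ (inj₂ refl)) _   = inj₂ (inj₁ refl)

data Neighbour (m : ℕ) : ℕ → ℕ → Set where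
  below : ∀ {j} → j ℕ.< m → Neighbour m j (suc j)
  above : ∀ {j} → j ℕ.< m → Neighbour m (suc j) j

neighbour-≤ : ∀ {m k s} → Neighbour m k s → k ℕ.< suc m
neighbour-≤ (below j<m) = ℕP.m≤n⇒m≤1+n j<m
neighbour-≤ (above j<m) = s≤s j<m

Lip-neighbour : ∀ {m h k s} → Lip m h → Neighbour m k s → Near (h k) (h s)
Lip-neighbour {h = h} lip (below {j} j<m) = near-sym {h (suc j)} {h j} (lip j j<m)
Lip-neighbour         lip (above {j} j<m) = lip j j<m

move-Lip : ∀ m d h s → Lip m h → (∀ k → Neighbour m k s → h k ≢ h s - unitStep d) →
           Lip m (shiftAt h s (unitStep d))
move-Lip m d h s lip free j j<m with suc j ℕ.≟ s | j ℕ.≟ s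
... | yes refl | _ =
  subst₂ Near (sym (shiftAt-here h (suc j) δ)) (sym (shiftAt-there h (suc j) δ j (ℕP.1+n≢n ∘ sym)))
    (near-move d {h (suc j)} {h j} (lip j j<m) (free j (below j<m)))
  where
  δ : ℤ
  δ = unitStep d
... | no _ | yes refl =
  subst₂ Near (sym (shiftAt-there h j δ (suc j) ℕP.1+n≢n)) (sym (shiftAt-here h j δ))
    (near-sym {h j + δ} {h (suc j)}
      (near-move d {h j} {h (suc j)} (near-sym {h (suc j)} {h j} (lip j j<m)) (free (suc j) (above j<m))))
  where
  δ : ℤ
  δ = unitStep d
... | no 1+j≢s | no j≢s =
  subst₂ Near (sym (shiftAt-there h s _ (suc j) 1+j≢s)) (sym (shiftAt-there h s _ j j≢s)) (lip j j<m)

minimise : (P : ℕ → Set) → Decidable P → (f : ℕ → ℤ) → ∀ k →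
  (∀ j → j ℕ.< k → ¬ P j) ⊎ Σ ℕ λ s → s ℕ.< k × P s × (∀ j → j ℕ.< k → P j → f s ≤ f j)
minimise P P? f zero = inj₁ λ _ ()
minimise P P? f (suc k) with minimise P P? f k | P? k
... | inj₁ none | no ¬Pk =
  inj₁ λ j j<1+k → below-or-last j<1+k (none j) (λ { refl → ¬Pk })
... | inj₁ none | yes Pk =
  inj₂ (k , ℕP.≤-refl , Pk , λ j j<1+k Pj →
    below-or-last j<1+k (λ j<k → ⊥-elim (none j j<k Pj)) (λ { refl → ℤP.≤-refl }))
... | inj₂ (s , s<k , Ps , least) | no ¬Pk =
  inj₂ (s , ℕP.m≤n⇒m≤1+n s<k , Ps , λ j j<1+k Pj →
    below-or-last j<1+k (λ j<k → least j j<k Pj) (λ { refl → ⊥-elim (¬Pk Pj) }))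
... | inj₂ (s , s<k , Ps , least) | yes Pk with f s ℤP.≤? f k
...   | yes fs≤fk = inj₂ (s , ℕP.m≤n⇒m≤1+n s<k , Ps , λ j j<1+k Pj →
          below-or-last j<1+k (λ j<k → least j j<k Pj) (λ { refl → fs≤fk }))
...   | no fs≰fk = inj₂ (k , ℕP.≤-refl , Pk , λ j j<1+k Pj →
          below-or-last j<1+k (λ j<k → ℤP.≤-trans (ℤP.<⇒≤ (ℤP.≰⇒> fs≰fk)) (least j j<k Pj))
                              (λ { refl → ℤP.≤-refl }))

-- Either G ≤ H on [0, m], or H can be raised at the lowest point s where H s < G s:
-- a neighbour k with H k = H s - 1 would satisfy H k < G k (G being Lipschitz),
-- contradicting the choice of s.
frontier : ∀ m (H G : Height) → Lip m G →
  (∀ j → j ℕ.≤ m → G j ≤ H j) ⊎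
  Σ ℕ λ s → s ℕ.≤ m × H s < G s × (∀ k → Neighbour m k s → H k ≢ H s - + 1)
frontier m H G lipG with minimise (λ j → H j < G j) (λ j → H j ℤP.<? G j) H (suc m)
... | inj₁ none = inj₁ λ j j≤m → ℤP.≮⇒≥ (none j (s≤s j≤m))
... | inj₂ (s , s<1+m , Hs<Gs , lowest) = inj₂ (s , ℕP.≤-pred s<1+m , Hs<Gs , free)
  where
  free : ∀ k → Neighbour m k s → H k ≢ H s - + 1
  free k nb Hk≡ = ℤP.<⇒≱ (pred-< (H s)) (subst (H s ≤_) Hk≡ (lowest k (neighbour-≤ nb) Hk<Gk))
    where
    Hk<Gk : H k < G k
    Hk<Gk = subst (_< G k) (sym Hk≡)
      (ℤP.<-≤-trans (ℤP.+-monoˡ-< (- + 1) Hs<Gs) (near-pred≤ {G k} {G s} (Lip-neighbour {h = G} lipG nb)))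

module Projection (n m : ℕ) .{{_ : NonZero n}} where

  -- Entry t of the tuple encoded by h: differences of heights in the middle, the
  -- residues of h 0 and -h m at the two Z_n-coordinates.
  projEntry : Height → ℕ → ℤ
  projEntry h zero    = + (h 0 %ℕ n)
  projEntry h (suc j) = if j ≡ᵇ m then + ((- h m) %ℕ n) else h (suc j) - h j

  π : Height → Tuple m
  π h = tabulate (λ t → projEntry h (toℕ t))

  entry-π : ∀ h t → t ℕ.< suc (suc m) → entry (π h) t ≡ projEntry h t
  entry-π h = entry-tabulate (projEntry h)

  projEntry-middle : ∀ h j → j ℕ.< m → projEntry h (suc j) ≡ h (suc j) - h j
  projEntry-middle h j j<m rewrite ≢⇒≡ᵇ-false (ℕP.<⇒≢ j<m) = refl

  projEntry-last : ∀ h → projEntry h (suc m) ≡ + ((- h m) %ℕ n)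
  projEntry-last h rewrite ≡ᵇ-refl m = refl

  projEntry-cong : ∀ h g → (∀ j → j ℕ.≤ m → h j ≡ g j) → ∀ t → t ℕ.≤ suc m →
                   projEntry h t ≡ projEntry g t
  projEntry-cong h g h≗g zero    _         = cong (λ x → + (x %ℕ n)) (h≗g 0 z≤n)
  projEntry-cong h g h≗g (suc j) (s≤s j≤m) with ℕP.m≤n⇒m<n∨m≡n j≤m
  ... | inj₁ j<m = trans (projEntry-middle h j j<m)
                     (trans (cong₂ _-_ (h≗g (suc j) j<m) (h≗g j j≤m)) (sym (projEntry-middle g j j<m)))
  ... | inj₂ refl = trans (projEntry-last h)
                      (trans (cong (λ x → + ((- x) %ℕ n)) (h≗g j j≤m)) (sym (projEntry-last g)))

  π-cong : ∀ h g → (∀ j → j ℕ.≤ m → h j ≡ g j) → π h ≡ π g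
  π-cong h g h≗g = entry-ext _ _ λ t t<m+2 →
    trans (entry-π h t t<m+2)
      (trans (projEntry-cong h g h≗g t (ℕP.≤-pred t<m+2)) (sym (entry-π g t t<m+2)))

  shiftEntry : ℕ → ℤ → ℤ → ℤ
  shiftEntry t x δ = if (t ≡ᵇ 0) ∨ (t ≡ᵇ suc m) then + ((x + δ) %ℕ n) else x + δ

  bump-here : ∀ p δ u t → t ≡ toℕ p → entry (bump n m p δ u) t ≡ shiftEntry t (entry u t) δ
  bump-here zero    δ u _ refl = entry-updateAt-here u zero _
  bump-here (suc p) δ u _ refl = entry-updateAt-here u (suc p) _

  bump-there : ∀ p δ u t → t ≢ toℕ p → entry (bump n m p δ u) t ≡ entry u t
  bump-there p δ u = entry-updateAt-there u p _

  shift-entry-at : ∀ h s δ → s ℕ.≤ m → shiftEntry s (projEntry h s) δ ≡ projEntry (shiftAt h s δ) s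
  shift-entry-at h zero δ _ =
    cong +_ (trans (residue-+ n (h 0) δ) (cong (_%ℕ n) (sym (shiftAt-here h 0 δ))))
  shift-entry-at h (suc j) δ j<m rewrite ≢⇒≡ᵇ-false (ℕP.<⇒≢ j<m) =
    trans (regroup (h (suc j)) (h j) δ)
      (sym (cong₂ _-_ (shiftAt-here h (suc j) δ) (shiftAt-there h (suc j) δ j (ℕP.1+n≢n ∘ sym))))
    where
    regroup : ∀ a b δ → (a - b) + δ ≡ (a + δ) - b
    regroup = solve-∀

  shift-entry-next : ∀ h s δ → s ℕ.≤ m →
    shiftEntry (suc s) (projEntry h (suc s)) (- δ) ≡ projEntry (shiftAt h s δ) (suc s)
  shift-entry-next h s δ s≤m with ℕP.m≤n⇒m<n∨m≡n s≤m
  ... | inj₂ refl rewrite ≡ᵇ-refl s =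
    cong +_ (trans (residue-+ n (- h s) (- δ))
      (cong (_%ℕ n) (sym (ℤP.neg-distrib-+ (h s) δ))))
  ... | inj₁ s<m rewrite ≢⇒≡ᵇ-false (ℕP.<⇒≢ s<m) =
    trans (regroup (h (suc s)) (h s) δ)
      (sym (cong₂ _-_ (shiftAt-there h s δ (suc s) ℕP.1+n≢n) (shiftAt-here h s δ)))
    where
    regroup : ∀ a b δ → (a - b) + - δ ≡ a - (b + δ)
    regroup = solve-∀

  shift-entry-off : ∀ h s δ t → t ≢ s → t ≢ suc s → t ℕ.≤ suc m →
                    projEntry h t ≡ projEntry (shiftAt h s δ) t
  shift-entry-off h s δ zero t≢s _ _ = cong (λ x → + (x %ℕ n)) (sym (shiftAt-there h s δ 0 t≢s))
  shift-entry-off h s δ (suc j) 1+j≢s 1+j≢1+s (s≤s j≤m) with ℕP.m≤n⇒m<n∨m≡n j≤m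
  ... | inj₁ j<m = trans (projEntry-middle h j j<m)
    (trans (sym (cong₂ _-_ (shiftAt-there h s δ (suc j) 1+j≢s) (shiftAt-there h s δ j j≢s)))
           (sym (projEntry-middle (shiftAt h s δ) j j<m)))
    where
    j≢s : j ≢ s
    j≢s = 1+j≢1+s ∘ cong suc
  ... | inj₂ refl = trans (projEntry-last h)
    (trans (cong (λ x → + ((- x) %ℕ n)) (sym (shiftAt-there h s δ j (1+j≢1+s ∘ cong suc))))
           (sym (projEntry-last (shiftAt h s δ))))

  bump-pair : ∀ (i : Fin (suc m)) δ h →
    bump n m (suc i) (- δ) (bump n m (inject₁ i) δ (π h)) ≡ π (shiftAt h (toℕ i) δ)
  bump-pair i δ h = entry-ext _ _ λ t t< → trans (agree t t<) (sym (entry-π h' t t<))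
    where
    open ≡-Reasoning
    s : ℕ
    s = toℕ i
    h' : Height
    h' = shiftAt h s δ
    s≤m : s ℕ.≤ m
    s≤m = ℕP.≤-pred (FinP.toℕ<n i)
    s≡ : s ≡ toℕ (inject₁ i)
    s≡ = sym (FinP.toℕ-inject₁ i)
    inner outer : Tuple m
    inner = bump n m (inject₁ i) δ (π h)
    outer = bump n m (suc i) (- δ) inner
    agree : ∀ t → t ℕ.< suc (suc m) → entry outer t ≡ projEntry h' t
    agree t t< with t ℕ.≟ s | t ℕ.≟ suc s
    ... | yes refl | _ = begin
      entry outer s                   ≡⟨ bump-there (suc i) (- δ) inner s (ℕP.1+n≢n ∘ sym) ⟩
      entry inner s                   ≡⟨ bump-here (inject₁ i) δ (π h) s s≡ ⟩
      shiftEntry s (entry (π h) s) δ  ≡⟨ cong (λ x → shiftEntry s x δ) (entry-π h s t<) ⟩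
      shiftEntry s (projEntry h s) δ  ≡⟨ shift-entry-at h s δ s≤m ⟩
      projEntry h' s                  ∎
    ... | no _ | yes refl = begin
      entry outer (suc s)                              ≡⟨ bump-here (suc i) (- δ) inner (suc s) refl ⟩
      shiftEntry (suc s) (entry inner (suc s)) (- δ)   ≡⟨ cong (λ x → shiftEntry (suc s) x (- δ)) inner≡ ⟩
      shiftEntry (suc s) (projEntry h (suc s)) (- δ)   ≡⟨ shift-entry-next h s δ s≤m ⟩
      projEntry h' (suc s)                             ∎
      where
      inner≡ : entry inner (suc s) ≡ projEntry h (suc s)
      inner≡ = trans (bump-there (inject₁ i) δ (π h) (suc s) (λ e → ℕP.1+n≢n (trans e (sym s≡))))
                     (entry-π h (suc s) t<)
    ... | no t≢s | no t≢1+s = begin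
      entry outer t   ≡⟨ bump-there (suc i) (- δ) inner t t≢1+s ⟩
      entry inner t   ≡⟨ bump-there (inject₁ i) δ (π h) t (λ e → t≢s (trans e (sym s≡))) ⟩
      entry (π h) t   ≡⟨ entry-π h t t< ⟩
      projEntry h t   ≡⟨ shift-entry-off h s δ t t≢s t≢1+s (ℕP.≤-pred t<) ⟩
      projEntry h' t  ∎

  letter-action : ∀ (f : Letter m) h → candidate n m f (π h) ≡ π (move f h)
  letter-action (left  , i) h = bump-pair i (+ 1) h
  letter-action (right , i) h = bump-pair i -[1+ 0 ] h

  -- The entries of π h telescope, leaving the two residues and h m - h 0.
  tupleSum-π : ∀ h → tupleSum (π h) ≡ + (h 0 %ℕ n) + ((h m - h 0) + + ((- h m) %ℕ n))
  tupleSum-π h = begin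
    tupleSum (π h)                                            ≡⟨ tupleSum-entries (π h) ⟩
    Σℤ (entry (π h)) (suc (suc m))                            ≡⟨ Σℤ-cong _ _ _ (entry-π h) ⟩
    projEntry h 0 + Σℤ (λ j → projEntry h (suc j)) (suc m)     ≡⟨ cong (_+_ (projEntry h 0))
                                                                   (Σℤ-snoc (λ j → projEntry h (suc j)) m) ⟩
    projEntry h 0 + (Σℤ (λ j → projEntry h (suc j)) m + projEntry h (suc m))
                                 ≡⟨ cong₂ (λ a b → projEntry h 0 + (a + b)) middle (projEntry-last h) ⟩
    + (h 0 %ℕ n) + ((h m - h 0) + + ((- h m) %ℕ n))           ∎
    where
    open ≡-Reasoning
    middle : Σℤ (λ j → projEntry h (suc j)) m ≡ h m - h 0
    middle = trans (Σℤ-cong _ _ m (projEntry-middle h)) (telescope h m)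

  π-vertex : ∀ h → Lip m h → IsVertex n m (π h)
  π-vertex h lip = entries⇒shape (π h) (first , last , middle) , ℤD.∣⇒∣ᵤ n∣sum
    where
    first : InZn n (entry (π h) 0)
    first = h 0 %ℕ n , n%ℕd<d (h 0) n , refl
    last : InZn n (entry (π h) (suc m))
    last = (- h m) %ℕ n , n%ℕd<d (- h m) n , trans (entry-π h (suc m) ℕP.≤-refl) (projEntry-last h)
    middle : ∀ j → j ℕ.< m → InTri (entry (π h) (suc j))
    middle j j<m = subst InTri
      (sym (trans (entry-π h (suc j) (s≤s (ℕP.m≤n⇒m≤1+n j<m))) (projEntry-middle h j j<m))) (lip j j<m)
    -- The sum telescopes to (r₀ - h 0) + (r₁ + h m) with residues r₀ of h 0, r₁ of -h m.
    n∣sum : + n ℤD.∣ tupleSum (π h)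
    n∣sum = subst (+ n ℤD.∣_) (sym (trans (tupleSum-π h) (regroup (h 0) (h m) _ _)))
      (ℤD.∣m∣n⇒∣m+n (ℤD.∣m⇒∣-m (residue-congruent n (h 0))) (ℤD.∣m⇒∣-m (residue-congruent n (- h m))))
      where
      regroup : ∀ a b r s → r + ((b - a) + s) ≡ - (a - r) + - ((- b) - s)
      regroup = solve-∀

  vertex-Lip : ∀ h → IsVertex n m (π h) → Lip m h
  vertex-Lip h (shape , _) j j<m =
    subst InTri (trans (entry-π h (suc j) (s≤s (ℕP.m≤n⇒m≤1+n j<m))) (projEntry-middle h j j<m))
      (proj₂ (proj₂ (shape⇒entries shape)) j j<m)

  -- The prefix sums of a vertex are Lipschitz heights projecting back to it.
  lift-entries : ∀ u → ShapeEntries n m u → + n ℤD.∣ tupleSum u → Σ Height λ h → Lip m h × π h ≡ u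
  lift-entries u ((k₀ , k₀<n , u₀≡k₀) , (k₁ , k₁<n , u₁≡k₁) , middle) n∣sum =
    h , lip , entry-ext _ _ λ t t< → trans (entry-π h t t<) (agree t t<)
    where
    h : Height
    h j = Σℤ (entry u) (suc j)
    h-step : ∀ j → h (suc j) - h j ≡ entry u (suc j)
    h-step j = trans (cong (_- h j) (Σℤ-snoc (entry u) (suc j))) (add-sub-cancel (h j) (entry u (suc j)))
    lip : Lip m h
    lip j j<m = subst InTri (sym (h-step j)) (middle j j<m)
    -- -h m is congruent to the last entry since the full sum h m + u_{m+1} is.
    n∣last : + n ℤD.∣ (- h m - + k₁)
    n∣last = subst (+ n ℤD.∣_)
      (trans (cong -_ (trans (tupleSum-entries u) (trans (Σℤ-snoc (entry u) (suc m))
                              (cong (_+_ (h m)) u₁≡k₁))))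
             (ℤP.neg-distrib-+ (h m) (+ k₁)))
      (ℤD.∣m⇒∣-m n∣sum)
    agree : ∀ t → t ℕ.< suc (suc m) → projEntry h t ≡ entry u t
    agree zero _ = trans (cong (λ x → + (x %ℕ n)) (trans (ℤP.+-identityʳ (entry u 0)) u₀≡k₀))
                         (trans (cong +_ (m<n⇒m%n≡m k₀<n)) (sym u₀≡k₀))
    agree (suc j) (s≤s j≤m+1) with ℕP.m≤n⇒m<n∨m≡n (ℕP.≤-pred j≤m+1)
    ... | inj₁ j<m = trans (projEntry-middle h j j<m) (h-step j)
    ... | inj₂ refl = trans (projEntry-last h)
      (trans (cong +_ (trans (residue-cong n (- h j) (+ k₁) n∣last) (m<n⇒m%n≡m k₁<n))) (sym u₁≡k₁))

  vertex-lift : ∀ u → IsVertex n m u → Σ Height λ h → Lip m h × π h ≡ u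
  vertex-lift u (shape , n∣sum) = lift-entries u (shape⇒entries shape) (ℤD.∣ᵤ⇒∣ n∣sum)

dist : ℕ → Height → Height → ℕ
dist m h g = Σℕ (λ j → ∣ g j - h j ∣) (suc m)

indicator : ℕ → ℕ → ℕ
indicator p j = if p ≡ᵇ j then 1 else 0

hits : ∀ {m} → Dir → ℕ → Letter m → ℕ
hits left  j (left  , i) = indicator (toℕ i) j
hits right j (right , i) = indicator (toℕ i) j
hits _     _ _           = 0

occ : ∀ {m} → Dir → ℕ → List (Letter m) → ℕ
occ d j []      = 0
occ d j (f ∷ w) = hits d j f ℕ.+ occ d j w

total : ∀ {m} → ℕ → List (Letter m) → ℕ
total j w = occ left j w ℕ.+ occ right j w

-- Each letter sits at exactly one position, so the totals add up to the length.
length-total : ∀ {m} (w : List (Letter m)) → length w ≡ Σℕ (λ j → total j w) (suc m)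
length-total {m} []            = sym (Σℕ-zero (suc m))
length-total {m} ((d , i) ∷ w) =
  sym (trans (Σℕ-point _ _ (suc m) (toℕ i) (FinP.toℕ<n i) (off d) (at d)) (cong suc (sym (length-total w))))
  where
  off : ∀ d j → j ≢ toℕ i → total j ((d , i) ∷ w) ≡ total j w
  off left  j j≢i rewrite ≢⇒≡ᵇ-false (j≢i ∘ sym) = refl
  off right j j≢i rewrite ≢⇒≡ᵇ-false (j≢i ∘ sym) = refl
  at : ∀ d → total (toℕ i) ((d , i) ∷ w) ≡ suc (total (toℕ i) w)
  at left  rewrite ≡ᵇ-refl (toℕ i) = refl
  at right rewrite ≡ᵇ-refl (toℕ i) = ℕP.+-suc _ _

occ-∈ : ∀ {m} d (i : Fin (suc m)) {w} → (d , i) ∈ w → 1 ℕ.≤ occ d (toℕ i) w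
occ-∈ left  i (here refl) rewrite ≡ᵇ-refl (toℕ i) = s≤s z≤n
occ-∈ right i (here refl) rewrite ≡ᵇ-refl (toℕ i) = s≤s z≤n
occ-∈ d i {f ∷ w} (there d,i∈w) = ℕP.≤-trans (occ-∈ d i d,i∈w) (ℕP.m≤n+m _ (hits d (toℕ i) f))

move-bound : ∀ {m} d (f : Letter m) h j → signed d (move f h j - h j) ≤ + hits d j f
move-bound d (d' , i) h j with j ℕ.≟ toℕ i
... | yes refl rewrite shiftAt-here h j (unitStep d') | add-sub-cancel (h j) (unitStep d') = unit-bound d d'
  where
  unit-bound : ∀ d d' → signed d (unitStep d') ≤ + hits d (toℕ i) (d' , i)
  unit-bound left  left  rewrite ≡ᵇ-refl (toℕ i) = ℤP.≤-refl
  unit-bound left  right = ℤ.-≤+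
  unit-bound right left  = ℤ.-≤+
  unit-bound right right rewrite ≡ᵇ-refl (toℕ i) = ℤP.≤-refl
... | no j≢i rewrite shiftAt-there h (toℕ i) (unitStep d') j j≢i | ℤP.+-inverseʳ (h j) =
  signed-zero≤ d _

Displacement : ∀ {m} → List (Letter m) → Height → Height → Set
Displacement w h g = ∀ d j → signed d (g j - h j) ≤ + occ d j w

displacement-refl : ∀ {m} h → Displacement {m} [] h h
displacement-refl h d j =
  subst (λ x → signed d x ≤ + 0) (sym (ℤP.+-inverseʳ (h j))) (signed-zero≤ d 0)

displacement-cons : ∀ {m} (f : Letter m) ws h g → Displacement ws (move f h) g →
                    Displacement (f ∷ ws) h g
displacement-cons f ws h g moved d j = begin
  signed d (g j - h j)                                      ≡⟨ signed-split d (h j) (move f h j) (g j) ⟩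
  signed d (move f h j - h j) + signed d (g j - move f h j) ≤⟨ ℤP.+-mono-≤ (move-bound d f h j) (moved d j) ⟩
  + hits d j f + + occ d j ws                               ≡⟨ ℤP.pos-+ (hits d j f) (occ d j ws) ⟨
  + occ d j (f ∷ ws)                                        ∎
  where open ℤP.≤-Reasoning

displacement-skip : ∀ {m} (f : Letter m) ws h g → Displacement ws h g → Displacement (f ∷ ws) h g
displacement-skip f ws h g moved d j = ℤP.≤-trans (moved d j) (ℤ.+≤+ (ℕP.m≤n+m _ (hits d j f)))

-- If both letters at i occur, the displacement at i is strictly below the number
-- of letters at i; summing over positions, the distance is below the length.
displacement-below-length : ∀ {m} (i : Fin (suc m)) {w h g} → Displacement w h g →
  (left , i) ∈ w → (right , i) ∈ w → dist m h g ℕ.< length w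
displacement-below-length {m} i {w} {h} {g} moved left∈w right∈w =
  subst (dist m h g ℕ.<_) (sym (length-total w))
    (Σℕ-mono-< (λ j → ∣ g j - h j ∣) (λ j → total j w) (suc m) (toℕ i) (FinP.toℕ<n i)
      (λ j _ → ℕP.≤-trans (bound j) (ℕP.m⊔n≤m+n (occ left j w) (occ right j w)))
      (ℕP.≤-<-trans (bound (toℕ i)) (⊔<+ (occ-∈ left i left∈w) (occ-∈ right i right∈w))))
  where
  bound : ∀ j → ∣ g j - h j ∣ ℕ.≤ occ left j w ⊔ occ right j w
  bound j = ∣∣≤⊔ (g j - h j) _ _ (moved left j) (moved right j)

module Lifting (n m : ℕ) .{{_ : NonZero n}} where
  open Projection n m

  step-Lip : ∀ f h → IsVertex n m (candidate n m f (π h)) → Lip m (move f h)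
  step-Lip f h isVertex = vertex-Lip (move f h) (subst (IsVertex n m) (letter-action f h) isVertex)

  lift-path : ∀ {u v} (p : Path n m u v) {w} → WordOf n m p w → ∀ h → Lip m h → π h ≡ u →
              Σ Height λ g → Lip m g × π g ≡ v × Displacement w h g
  lift-path (stop _) stop h lip πh≡u = h , lip , πh≡u , displacement-refl {m} h
  lift-path (step _ p) (step {f = f} {ws = ws} (inj₁ (isVertex , v≡)) word) h lip refl
    with lift-path p word (move f h) (step-Lip f h isVertex) (sym (trans v≡ (letter-action f h)))
  ... | g , lip-g , πg≡v , moved = g , lip-g , πg≡v , displacement-cons f ws h g moved
  lift-path (step _ p) (step {f = f} {ws = ws} (inj₂ (_ , v≡u)) word) h lip πh≡u
    with lift-path p word h lip (trans πh≡u (sym v≡u))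
  ... | g , lip-g , πg≡v , moved = g , lip-g , πg≡v , displacement-skip f ws h g moved

  source-vertex : ∀ {u v} → Path n m u v → IsVertex n m u
  source-vertex (stop x)   = x
  source-vertex (step a _) = proj₁ a

  word-length : ∀ {u v} (p : Path n m u v) {w} → WordOf n m p w → len p ≡ length w
  word-length (stop _)   stop          = refl
  word-length (step _ p) (step _ word) = cong suc (word-length p word)

module Monotone (n m : ℕ) .{{_ : NonZero n}} where
  open Projection n m

  dist-move : ∀ h g d s → s ℕ.≤ m → signed d (h s) < signed d (g s) →
              dist m (shiftAt h s (unitStep d)) g ℕ.< dist m h g
  dist-move h g d s s≤m closer = Σℕ-mono-< _ _ (suc m) s (s≤s s≤m) termwise at-s
    where
    δ : ℤ
    δ = unitStep d
    regroup : ∀ a b δ → a - (b + δ) ≡ (a - b) - δ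
    regroup = solve-∀
    at-s : ∣ g s - shiftAt h s δ s ∣ ℕ.< ∣ g s - h s ∣
    at-s = subst₂ ℕ._<_
      (begin
        ∣ signed d (g s - h s) - + 1 ∣   ≡⟨ cong ∣_∣ (signed-back d (g s - h s)) ⟨
        ∣ signed d ((g s - h s) - δ) ∣   ≡⟨ signed-∣∣ d _ ⟩
        ∣ (g s - h s) - δ ∣              ≡⟨ cong ∣_∣ (regroup (g s) (h s) δ) ⟨
        ∣ g s - (h s + δ) ∣              ≡⟨ cong (λ x → ∣ g s - x ∣) (shiftAt-here h s δ) ⟨
        ∣ g s - shiftAt h s δ s ∣        ∎)
      (signed-∣∣ d (g s - h s))
      (∣pred∣< _ (subst (+ 0 <_) (sym (signed-diff d (g s) (h s))) (<⇒0<- closer)))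
      where open ≡-Reasoning
    termwise : ∀ j → j ℕ.< suc m → ∣ g j - shiftAt h s δ j ∣ ℕ.≤ ∣ g j - h j ∣
    termwise j _ with j ℕ.≟ s
    ... | yes refl = ℕP.<⇒≤ at-s
    ... | no j≢s   = ℕP.≤-reflexive (cong (λ x → ∣ g j - x ∣) (shiftAt-there h s δ j j≢s))

  Advance : Height → Height → Set
  Advance h g = Σ Dir λ d → Σ ℕ λ s →
    s ℕ.≤ m × signed d (h s) < signed d (g s) × Lip m (shiftAt h s (unitStep d))

  -- The frontier point of the d-components of h and g is such a move.
  advance : ∀ h g d → Lip m h →
    Σ ℕ (λ s → s ℕ.≤ m × signed d (h s) < signed d (g s) ×
               (∀ k → Neighbour m k s → signed d (h k) ≢ signed d (h s) - + 1)) →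
    Advance h g
  advance h g d lip-h (s , s≤m , closer , free) =
    d , s , s≤m , closer ,
    move-Lip m d h s lip-h (λ k nb hk≡ → free k nb (trans (cong (signed d) hk≡) (signed-back d (h s))))

  step-toward : ∀ h g → Lip m h → Lip m g → (∀ j → j ℕ.≤ m → h j ≡ g j) ⊎ Advance h g
  step-toward h g lip-h lip-g
    with frontier m h g lip-g
       | frontier m (λ j → - h j) (λ j → - g j) (Lip-signed {h = g} right lip-g)
  ... | inj₂ up | _         = inj₂ (advance h g left lip-h up)
  ... | inj₁ _  | inj₂ down = inj₂ (advance h g right lip-h down)
  ... | inj₁ g≤h | inj₁ -g≤-h =
    inj₁ λ j j≤m → ℤP.≤-antisym (ℤP.neg-cancel-≤ (-g≤-h j j≤m)) (g≤h j j≤m)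

  move-adjacent : ∀ h d s → s ℕ.≤ m → Lip m h → Lip m (shiftAt h s (unitStep d)) →
                  Adj n m (π h) (π (shiftAt h s (unitStep d)))
  move-adjacent h d s s≤m lip-h lip-h' =
    π-vertex h lip-h , π-vertex h' lip-h' , i , as-adjacency (opposite d) back
    where
    h' : Height
    h' = shiftAt h s (unitStep d)
    i : Fin (suc m)
    i = fromℕ< (s≤s s≤m)
    undo : ∀ j → j ℕ.≤ m → move (opposite d , i) h' j ≡ h j
    undo j _ = trans (cong₂ (λ t δ → shiftAt h' t δ j) (FinP.toℕ-fromℕ< (s≤s s≤m)) (unitStep-opposite d))
                     (shiftAt-cancel h s (unitStep d) j)
    back : π h ≡ candidate n m (opposite d , i) (π h')
    back = sym (trans (letter-action (opposite d , i) h') (π-cong _ _ undo))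
    as-adjacency : ∀ {u v} e → u ≡ candidate n m (e , i) v →
                   (u ≡ candidate n m (left , i) v) ⊎ (u ≡ candidate n m (right , i) v)
    as-adjacency left  = inj₁
    as-adjacency right = inj₂

  monotone-path : ∀ h g → Lip m h → Lip m g → ∀ {x y} → π h ≡ x → π g ≡ y →
                  Σ (Path n m x y) λ q → len q ℕ.≤ dist m h g
  monotone-path h₀ g lip-h₀ lip-g refl refl = go h₀ lip-h₀ (<-wellFounded (dist m h₀ g))
    where
    go : ∀ h → Lip m h → Acc ℕ._<_ (dist m h g) → Σ (Path n m (π h) (π g)) λ q → len q ℕ.≤ dist m h g
    go h lip-h (acc shorter) with step-toward h g lip-h lip-g
    ... | inj₁ h≗g rewrite π-cong h g h≗g = stop (π-vertex g lip-g) , z≤n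
    ... | inj₂ (d , s , s≤m , closer , lip-h')
      with go (shiftAt h s (unitStep d)) lip-h' (shorter (dist-move h g d s s≤m closer))
    ...   | q , len-q≤ =
      step (move-adjacent h d s s≤m lip-h lip-h') q , ℕP.≤-<-trans len-q≤ (dist-move h g d s s≤m closer)

lemma3p2 : (n m : ℕ) .{{_ : NonZero n}} {u v : Tuple m} (p : Path n m u v) →
    IsGeodesic n m p → (w : List (Letter m)) → WordOf n m p w →
    (i : Fin (suc m)) → ¬ (((left , i) ∈ w) × ((right , i) ∈ w))
lemma3p2 n m p geodesic w word i (left∈w , right∈w) =
  let (h , lip-h , πh≡u)         = vertex-lift _ (source-vertex p)
      (g , lip-g , πg≡v , moved) = lift-path p word h lip-h πh≡u
      (q , len-q≤dist)           = monotone-path h g lip-h lip-g πh≡u πg≡v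
      dist<len-p                 = subst (dist m h g ℕ.<_) (sym (word-length p word))
                                     (displacement-below-length i {h = h} {g = g} moved left∈w right∈w)
  in ℕP.<⇒≱ (ℕP.≤-<-trans len-q≤dist dist<len-p) (geodesic q)
  where
  open Projection n m
  open Lifting n m
  open Monotone n m
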